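{- Let $M$ be an MV-algebra (viewed equivalently as a BL-algebra satisfying $x^{ -- }=x$). A mapping $\sigma:M\to M$ is a state-MV-operator on $M$ if and only if $\sigma$ is a state-operator on $M$ taken as a BL-algebra. Moreover, in that case $\sigma$ is a strong state-operator.
   Context: A BL-algebra is an algebra $(A,\wedge,\vee,\odot,\to,0,1)$ of type $(2,2,2,2,0,0)$ such that $(A,\wedge,\vee,0,1)$ is a bounded lattice, $(A,\odot,1)$ is a commutative monoid, and for all $a,b,c\in A$: $c\le a\to b$ iff $a\odot c\le b$; $a\wedge b=a\odot(a\to b)$; $(a\to b)\vee(b\to a)=1$. Write $x^-:=x\to 0$, $x\oplus y:=(x^-\odot y^-)^-$ and $x\ominus y:=x\odot y^-$. BL-algebras satisfying $x^{ -- }=x$ are exactly (term-equivalently) MV-algebras $(M,\oplus,\odot,{}^-,0,1)$, with $x\to y=x^-\oplus y$. A state-MV-operator on an MV-algebra $M$ is a map $\sigma:M\to M$ such that for all $x,y$: $\sigma(1)=1$; $\sigma(x^-)=\sigma(x)^-$; $\sigma(x\oplus y)=\sigma(x)\oplus\sigma(y\ominus(x\odot y))$; $\sigma(\sigma(x)\oplus\sigma(y))=\sigma(x)\oplus\sigma(y)$. A state-operator on a BL-algebra $A$ is a map $\sigma:A\to A$ such that for all $x,y\in A$: (1) $\sigma(0)=0$; (2) $\sigma(x\to y)=\sigma(x)\to\sigma(x\wedge y)$; (3) $\sigma(x\odot y)=\sigma(x)\odot\sigma(x\to x\odot y)$; (4) $\sigma(\sigma(x)\odot\sigma(y))=\sigma(x)\odot\sigma(y)$;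 (5) $\sigma(\sigma(x)\to\sigma(y))=\sigma(x)\to\sigma(y)$. A strong state-operator is a map satisfying (1), (2), (4), (5) and (3') $\sigma(x\odot y)=\sigma(x)\odot\sigma(x^-\vee y)$ for all $x,y$. -}

module Defs where

open import Data.Product using (_×_)
open import Relation.Binary.PropositionalEquality using (_≡_)

record BLAlgebra : Set₁ where
  infixr 8 _⊙_
  infixr 7 _∧_
  infixr 6 _∨_
  infixr 5 _⇒_
  field
    Carrier : Set
    _∧_ _∨_ _⊙_ _⇒_ : Carrier → Carrier → Carrier
    𝟘 𝟙 : Carrier
    ∧-assoc : ∀ x y z → (x ∧ y) ∧ z ≡ x ∧ (y ∧ z)
    ∨-assoc : ∀ x y z → (x ∨ y) ∨ z ≡ x ∨ (y ∨ z)
    ∧-comm : ∀ x y → x ∧ y ≡ y ∧ x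
    ∨-comm : ∀ x y → x ∨ y ≡ y ∨ x
    ∧-absorb-∨ : ∀ x y → x ∧ (x ∨ y) ≡ x
    ∨-absorb-∧ : ∀ x y → x ∨ (x ∧ y) ≡ x
    𝟘-least : ∀ x → 𝟘 ∧ x ≡ 𝟘
    𝟙-greatest : ∀ x → x ∧ 𝟙 ≡ x
    ⊙-assoc : ∀ x y z → (x ⊙ y) ⊙ z ≡ x ⊙ (y ⊙ z)
    ⊙-comm : ∀ x y → x ⊙ y ≡ y ⊙ x
    ⊙-identityʳ : ∀ x → x ⊙ 𝟙 ≡ x
    residuation⇒ : ∀ a b c → c ∧ (a ⇒ b) ≡ c → (a ⊙ c) ∧ b ≡ a ⊙ c
    residuation⇐ : ∀ a b c → (a ⊙ c) ∧ b ≡ a ⊙ c → c ∧ (a ⇒ b) ≡ c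
    divisibility : ∀ a b → a ∧ b ≡ a ⊙ (a ⇒ b)
    prelinearity : ∀ a b → (a ⇒ b) ∨ (b ⇒ a) ≡ 𝟙

  _≤_ : Carrier → Carrier → Set
  x ≤ y = x ∧ y ≡ x

  infix 10 _⁻
  _⁻ : Carrier → Carrier
  x ⁻ = x ⇒ 𝟘

  infixr 6 _⊕_
  infixl 7 _⊖_
  _⊕_ : Carrier → Carrier → Carrier
  x ⊕ y = ((x ⁻) ⊙ (y ⁻)) ⁻

  _⊖_ : Carrier → Carrier → Carrier
  x ⊖ y = x ⊙ (y ⁻)

IsMV : BLAlgebra → Set
IsMV A = ∀ x → (x ⁻) ⁻ ≡ x
  where open BLAlgebra A

module _ (A : BLAlgebra) where
  open BLAlgebra A

  record IsStateMVOperator (σ : Carrier → Carrier) : Set where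
    field
      mv-one : σ 𝟙 ≡ 𝟙
      mv-neg : ∀ x → σ (x ⁻) ≡ σ x ⁻
      mv-⊕ : ∀ x y → σ (x ⊕ y) ≡ σ x ⊕ σ (y ⊖ (x ⊙ y))
      mv-idem : ∀ x y → σ (σ x ⊕ σ y) ≡ σ x ⊕ σ y

  record IsStateOperator (σ : Carrier → Carrier) : Set where
    field
      so-zero : σ 𝟘 ≡ 𝟘
      so-⇒ : ∀ x y → σ (x ⇒ y) ≡ σ x ⇒ σ (x ∧ y)
      so-⊙ : ∀ x y → σ (x ⊙ y) ≡ σ x ⊙ σ (x ⇒ x ⊙ y)
      so-idem-⊙ : ∀ x y → σ (σ x ⊙ σ y) ≡ σ x ⊙ σ y
      so-idem-⇒ : ∀ x y → σ (σ x ⇒ σ y) ≡ σ x ⇒ σ y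

  -- strong state-operator: (1),(2),(4),(5) and (3')
  record IsStrongStateOperator (σ : Carrier → Carrier) : Set where
    field
      sso-zero : σ 𝟘 ≡ 𝟘
      sso-⇒ : ∀ x y → σ (x ⇒ y) ≡ σ x ⇒ σ (x ∧ y)
      sso-⊙ : ∀ x y → σ (x ⊙ y) ≡ σ x ⊙ σ (x ⁻ ∨ y)
      sso-idem-⊙ : ∀ x y → σ (σ x ⊙ σ y) ≡ σ x ⊙ σ y
      sso-idem-⇒ : ∀ x y → σ (σ x ⇒ σ y) ≡ σ x ⇒ σ y

-- In an MV-algebra x ⊕ y = x⁻ ⇒ y and y ⊖ (x ⊙ y) = x⁻ ∧ y, so once σ commutes with
-- negation the MV-axiom for σ (x ⊕ y) is the BL-axiom (2) for σ (x⁻ ⇒ y), and the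
-- MV-idempotency of σ on ⊕ is (5) at x⁻.  Conversely (2) at y = 0 gives σ (x⁻) = σ x⁻,
-- and then (3) and (4) follow from (2) and (5) by writing x ⊙ y = (x ⇒ y⁻)⁻.
-- The strong form (3') is (3) together with x ⇒ x ⊙ y = x⁻ ∨ y.
module Submission where

open import Defs
open import Algebra.Lattice.Bundles using (Lattice)
open import Algebra.Lattice.Properties.Lattice using (∧-idem; ∨-∧-orderTheoreticLattice)
open import Data.Product using (_×_; _,_)
open import Function.Bundles using (_⇔_; mk⇔; Equivalence)
import Relation.Binary.Lattice as Order
open import Relation.Binary.PropositionalEquality

module BLProperties (A : BLAlgebra) where
  open BLAlgebra A
  open ≡-Reasoning

  lattice : Lattice _ _
  lattice = record
    { _∨_ = _∨_
    ; _∧_ = _∧_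
    ; isLattice = record
      { isEquivalence = isEquivalence
      ; ∨-comm = ∨-comm
      ; ∨-assoc = ∨-assoc
      ; ∨-cong = cong₂ _∨_
      ; ∧-comm = ∧-comm
      ; ∧-assoc = ∧-assoc
      ; ∧-cong = cong₂ _∧_
      ; absorptive = ∨-absorb-∧ , ∧-absorb-∨
      }
    }

  -- The library orders a lattice by x ≡ x ∧ y, the symmetric form of _≤_.
  private module L = Order.Lattice (∨-∧-orderTheoreticLattice lattice)

  ≤-refl : ∀ x → x ≤ x
  ≤-refl x = sym L.refl

  ≤-trans : ∀ {x y z} → x ≤ y → y ≤ z → x ≤ z
  ≤-trans p q = sym (L.trans (sym p) (sym q))

  ≤-antisym : ∀ {x y} → x ≤ y → y ≤ x → x ≡ y
  ≤-antisym p q = L.antisym (sym p) (sym q)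

  x≤x∨y : ∀ x y → x ≤ (x ∨ y)
  x≤x∨y x y = sym (L.x≤x∨y x y)

  y≤x∨y : ∀ x y → y ≤ (x ∨ y)
  y≤x∨y x y = sym (L.y≤x∨y x y)

  ∨-least : ∀ {x y z} → x ≤ z → y ≤ z → (x ∨ y) ≤ z
  ∨-least p q = sym (L.∨-least (sym p) (sym q))

  x∧y≤x : ∀ x y → (x ∧ y) ≤ x
  x∧y≤x x y = sym (L.x∧y≤x x y)

  x∧y≤y : ∀ x y → (x ∧ y) ≤ y
  x∧y≤y x y = sym (L.x∧y≤y x y)

  ∧-greatest : ∀ {x y z} → x ≤ y → x ≤ z → x ≤ (y ∧ z)
  ∧-greatest p q = sym (L.∧-greatest (sym p) (sym q))

  ⊙-monoˡ-≤ : ∀ {x y} z → x ≤ y → (x ⊙ z) ≤ (y ⊙ z)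
  ⊙-monoˡ-≤ {x} {y} z x≤y = subst (_≤ (y ⊙ z)) (⊙-comm z x)
    (residuation⇒ z (y ⊙ z) x (≤-trans x≤y y≤z⇒y⊙z))
    where
    y≤z⇒y⊙z : y ≤ (z ⇒ y ⊙ z)
    y≤z⇒y⊙z = residuation⇐ z (y ⊙ z) y (subst (_≤ (y ⊙ z)) (⊙-comm y z) (≤-refl (y ⊙ z)))

  ⁻-antitone : ∀ {x y} → x ≤ y → (y ⁻) ≤ (x ⁻)
  ⁻-antitone {x} {y} x≤y = residuation⇐ x 𝟘 (y ⁻)
    (≤-trans (⊙-monoˡ-≤ (y ⁻) x≤y) (residuation⇒ y 𝟘 (y ⁻) (≤-refl (y ⁻))))

  ⇒-curry : ∀ x y z → x ⊙ y ⇒ z ≡ x ⇒ y ⇒ z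
  ⇒-curry x y z = ≤-antisym (curry (≤-refl _)) (uncurry (≤-refl _))
    where
    ⊙-exchange : ∀ w → y ⊙ (x ⊙ w) ≡ (x ⊙ y) ⊙ w
    ⊙-exchange w = trans (sym (⊙-assoc y x w)) (cong (_⊙ w) (⊙-comm y x))

    curry : ∀ {w} → w ≤ (x ⊙ y ⇒ z) → w ≤ (x ⇒ y ⇒ z)
    curry {w} p = residuation⇐ x (y ⇒ z) w (residuation⇐ y z (x ⊙ w)
      (subst (_≤ z) (sym (⊙-exchange w)) (residuation⇒ (x ⊙ y) z w p)))

    uncurry : ∀ {w} → w ≤ (x ⇒ y ⇒ z) → w ≤ (x ⊙ y ⇒ z)
    uncurry {w} p = residuation⇐ (x ⊙ y) z w
      (subst (_≤ z) (⊙-exchange w) (residuation⇒ y z (x ⊙ w) (residuation⇒ x (y ⇒ z) w p)))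

  ⁻-⊙ : ∀ x y → (x ⊙ y) ⁻ ≡ x ⇒ y ⁻
  ⁻-⊙ x y = ⇒-curry x y 𝟘

  ⊖-⊙ : ∀ x y → y ⊖ (x ⊙ y) ≡ x ⁻ ∧ y
  ⊖-⊙ x y = begin
    y ⊙ (x ⊙ y) ⁻  ≡⟨ cong (λ w → y ⊙ w ⁻) (⊙-comm x y) ⟩
    y ⊙ (y ⊙ x) ⁻  ≡⟨ cong (y ⊙_) (⁻-⊙ y x) ⟩
    y ⊙ (y ⇒ x ⁻)  ≡⟨ divisibility y (x ⁻) ⟨
    y ∧ x ⁻        ≡⟨ ∧-comm y (x ⁻) ⟩
    x ⁻ ∧ y        ∎

  x∧𝟘≡𝟘 : ∀ x → x ∧ 𝟘 ≡ 𝟘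
  x∧𝟘≡𝟘 x = trans (∧-comm x 𝟘) (𝟘-least x)

  𝟘⁻≡𝟙 : 𝟘 ⁻ ≡ 𝟙
  𝟘⁻≡𝟙 = trans (sym (trans (∧-comm 𝟙 (𝟘 ⁻)) (𝟙-greatest (𝟘 ⁻))))
    (residuation⇐ 𝟘 𝟘 𝟙 (trans (cong (_∧ 𝟘) (⊙-identityʳ 𝟘))
      (trans (∧-idem lattice 𝟘) (sym (⊙-identityʳ 𝟘)))))

module MVProperties (M : BLAlgebra) (involutive : IsMV M) where
  open BLAlgebra M
  open BLProperties M
  open ≡-Reasoning

  ⊕≡⁻⇒ : ∀ x y → x ⊕ y ≡ x ⁻ ⇒ y
  ⊕≡⁻⇒ x y = trans (⁻-⊙ (x ⁻) (y ⁻)) (cong (x ⁻ ⇒_) (involutive y))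

  ⇒≡⁻⊕ : ∀ x y → x ⇒ y ≡ x ⁻ ⊕ y
  ⇒≡⁻⊕ x y = trans (cong (_⇒ y) (sym (involutive x))) (sym (⊕≡⁻⇒ (x ⁻) y))

  ⁻-⇒ : ∀ x y → (x ⇒ y) ⁻ ≡ x ⊙ y ⁻
  ⁻-⇒ x y = begin
    (x ⇒ y) ⁻           ≡⟨ cong (λ w → (x ⇒ w) ⁻) (involutive y) ⟨
    (x ⇒ y ⁻ ⁻) ⁻       ≡⟨ cong _⁻ (⁻-⊙ x (y ⁻)) ⟨
    (x ⊙ y ⁻) ⁻ ⁻       ≡⟨ involutive (x ⊙ y ⁻) ⟩
    x ⊙ y ⁻             ∎

  𝟙⁻≡𝟘 : 𝟙 ⁻ ≡ 𝟘
  𝟙⁻≡𝟘 = trans (cong _⁻ (sym 𝟘⁻≡𝟙)) (involutive 𝟘)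

  ⁻-∧ : ∀ x y → (x ∧ y) ⁻ ≡ x ⁻ ∨ y ⁻
  ⁻-∧ x y = ≤-antisym
    (⁻-swap (∧-greatest (⁻-swap (x≤x∨y (x ⁻) (y ⁻))) (⁻-swap (y≤x∨y (x ⁻) (y ⁻)))))
    (∨-least (⁻-antitone (x∧y≤x x y)) (⁻-antitone (x∧y≤y x y)))
    where
    ⁻-swap : ∀ {a b} → (a ⁻) ≤ b → (b ⁻) ≤ a
    ⁻-swap {a} {b} p = subst ((b ⁻) ≤_) (involutive a) (⁻-antitone p)

  ⁻-∧⁻ : ∀ x y → (x ∧ y ⁻) ⁻ ≡ x ⇒ x ⊙ y
  ⁻-∧⁻ x y = begin
    (x ∧ y ⁻) ⁻          ≡⟨ cong _⁻ (divisibility x (y ⁻)) ⟩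
    (x ⊙ (x ⇒ y ⁻)) ⁻    ≡⟨ cong (λ w → (x ⊙ w) ⁻) (⁻-⊙ x y) ⟨
    (x ⊙ (x ⊙ y) ⁻) ⁻    ≡⟨ ⁻-⊙ x ((x ⊙ y) ⁻) ⟩
    x ⇒ (x ⊙ y) ⁻ ⁻      ≡⟨ cong (x ⇒_) (involutive (x ⊙ y)) ⟩
    x ⇒ x ⊙ y            ∎

  ⇒-⊙-self : ∀ x y → x ⇒ x ⊙ y ≡ x ⁻ ∨ y
  ⇒-⊙-self x y = begin
    x ⇒ x ⊙ y        ≡⟨ ⁻-∧⁻ x y ⟨
    (x ∧ y ⁻) ⁻      ≡⟨ ⁻-∧ x (y ⁻) ⟩
    x ⁻ ∨ y ⁻ ⁻      ≡⟨ cong (x ⁻ ∨_) (involutive y) ⟩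
    x ⁻ ∨ y          ∎

module StateOperators (M : BLAlgebra) (involutive : IsMV M)
                      (σ : BLAlgebra.Carrier M → BLAlgebra.Carrier M) where
  open BLAlgebra M
  open BLProperties M
  open MVProperties M involutive
  open ≡-Reasoning

  Preserves⁻ : Set
  Preserves⁻ = ∀ x → σ (x ⁻) ≡ σ x ⁻

  ⇒-Law : Set
  ⇒-Law = ∀ x y → σ (x ⇒ y) ≡ σ x ⇒ σ (x ∧ y)

  ⇒-Idempotent : Set
  ⇒-Idempotent = ∀ x y → σ (σ x ⇒ σ y) ≡ σ x ⇒ σ y

  ⊕-Law : Set
  ⊕-Law = ∀ x y → σ (x ⊕ y) ≡ σ x ⊕ σ (y ⊖ (x ⊙ y))

  ⊕-Idempotent : Set
  ⊕-Idempotent = ∀ x y → σ (σ x ⊕ σ y) ≡ σ x ⊕ σ y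

  ⁻-preserved : σ 𝟘 ≡ 𝟘 → ⇒-Law → Preserves⁻
  ⁻-preserved σ𝟘≡𝟘 law x = begin
    σ (x ⇒ 𝟘)          ≡⟨ law x 𝟘 ⟩
    σ x ⇒ σ (x ∧ 𝟘)    ≡⟨ cong (λ w → σ x ⇒ σ w) (x∧𝟘≡𝟘 x) ⟩
    σ x ⇒ σ 𝟘          ≡⟨ cong (σ x ⇒_) σ𝟘≡𝟘 ⟩
    σ x ⇒ 𝟘            ∎

  ⊙-law : Preserves⁻ → ⇒-Law → ∀ x y → σ (x ⊙ y) ≡ σ x ⊙ σ (x ⇒ x ⊙ y)
  ⊙-law neg law x y = begin
    σ (x ⊙ y)                ≡⟨ cong σ (trans (⁻-⇒ x (y ⁻)) (cong (x ⊙_) (involutive y))) ⟨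
    σ ((x ⇒ y ⁻) ⁻)          ≡⟨ neg (x ⇒ y ⁻) ⟩
    σ (x ⇒ y ⁻) ⁻            ≡⟨ cong _⁻ (law x (y ⁻)) ⟩
    (σ x ⇒ σ (x ∧ y ⁻)) ⁻    ≡⟨ ⁻-⇒ (σ x) (σ (x ∧ y ⁻)) ⟩
    σ x ⊙ σ (x ∧ y ⁻) ⁻      ≡⟨ cong (σ x ⊙_) (neg (x ∧ y ⁻)) ⟨
    σ x ⊙ σ ((x ∧ y ⁻) ⁻)    ≡⟨ cong (λ w → σ x ⊙ σ w) (⁻-∧⁻ x y) ⟩
    σ x ⊙ σ (x ⇒ x ⊙ y)      ∎

  ⊙-idempotent : Preserves⁻ → ⇒-Idempotent → ∀ x y → σ (σ x ⊙ σ y) ≡ σ x ⊙ σ y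
  ⊙-idempotent neg idem x y = begin
    σ (σ x ⊙ σ y)            ≡⟨ cong (λ w → σ (σ x ⊙ w)) σy≡σ[y⁻]⁻ ⟩
    σ (σ x ⊙ σ (y ⁻) ⁻)      ≡⟨ cong σ (⁻-⇒ (σ x) (σ (y ⁻))) ⟨
    σ ((σ x ⇒ σ (y ⁻)) ⁻)    ≡⟨ neg (σ x ⇒ σ (y ⁻)) ⟩
    σ (σ x ⇒ σ (y ⁻)) ⁻      ≡⟨ cong _⁻ (idem x (y ⁻)) ⟩
    (σ x ⇒ σ (y ⁻)) ⁻        ≡⟨ ⁻-⇒ (σ x) (σ (y ⁻)) ⟩
    σ x ⊙ σ (y ⁻) ⁻          ≡⟨ cong (σ x ⊙_) σy≡σ[y⁻]⁻ ⟨
    σ x ⊙ σ y                ∎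
    where
    σy≡σ[y⁻]⁻ : σ y ≡ σ (y ⁻) ⁻
    σy≡σ[y⁻]⁻ = trans (cong σ (sym (involutive y))) (neg (y ⁻))

  ⊕-law⇔⇒-law : Preserves⁻ → ⊕-Law ⇔ ⇒-Law
  ⊕-law⇔⇒-law neg = mk⇔ to from
    where
    to : ⊕-Law → ⇒-Law
    to plus x y = begin
      σ (x ⇒ y)                       ≡⟨ cong σ (⇒≡⁻⊕ x y) ⟩
      σ (x ⁻ ⊕ y)                     ≡⟨ plus (x ⁻) y ⟩
      σ (x ⁻) ⊕ σ (y ⊖ (x ⁻ ⊙ y))     ≡⟨ cong₂ (λ u v → u ⊕ σ v) (neg x) (⊖-⊙ (x ⁻) y) ⟩
      σ x ⁻ ⊕ σ (x ⁻ ⁻ ∧ y)           ≡⟨ cong (λ w → σ x ⁻ ⊕ σ (w ∧ y)) (involutive x) ⟩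
      σ x ⁻ ⊕ σ (x ∧ y)               ≡⟨ ⇒≡⁻⊕ (σ x) (σ (x ∧ y)) ⟨
      σ x ⇒ σ (x ∧ y)                 ∎

    from : ⇒-Law → ⊕-Law
    from law x y = begin
      σ (x ⊕ y)                 ≡⟨ cong σ (⊕≡⁻⇒ x y) ⟩
      σ (x ⁻ ⇒ y)               ≡⟨ law (x ⁻) y ⟩
      σ (x ⁻) ⇒ σ (x ⁻ ∧ y)     ≡⟨ cong₂ (λ u v → u ⇒ σ v) (neg x) (sym (⊖-⊙ x y)) ⟩
      σ x ⁻ ⇒ σ (y ⊖ (x ⊙ y))   ≡⟨ ⊕≡⁻⇒ (σ x) (σ (y ⊖ (x ⊙ y))) ⟨
      σ x ⊕ σ (y ⊖ (x ⊙ y))     ∎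

  ⊕-idempotent⇔⇒-idempotent : Preserves⁻ → ⊕-Idempotent ⇔ ⇒-Idempotent
  ⊕-idempotent⇔⇒-idempotent neg = mk⇔ to from
    where
    to : ⊕-Idempotent → ⇒-Idempotent
    to idem x y = begin
      σ (σ x ⇒ σ y)             ≡⟨ cong σ (⇒≡⁻⊕ (σ x) (σ y)) ⟩
      σ (σ x ⁻ ⊕ σ y)           ≡⟨ cong (λ w → σ (w ⊕ σ y)) (neg x) ⟨
      σ (σ (x ⁻) ⊕ σ y)         ≡⟨ idem (x ⁻) y ⟩
      σ (x ⁻) ⊕ σ y             ≡⟨ cong (_⊕ σ y) (neg x) ⟩
      σ x ⁻ ⊕ σ y               ≡⟨ ⇒≡⁻⊕ (σ x) (σ y) ⟨
      σ x ⇒ σ y                 ∎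

    from : ⇒-Idempotent → ⊕-Idempotent
    from idem x y = begin
      σ (σ x ⊕ σ y)             ≡⟨ cong σ (⊕≡⁻⇒ (σ x) (σ y)) ⟩
      σ (σ x ⁻ ⇒ σ y)           ≡⟨ cong (λ w → σ (w ⇒ σ y)) (neg x) ⟨
      σ (σ (x ⁻) ⇒ σ y)         ≡⟨ idem (x ⁻) y ⟩
      σ (x ⁻) ⇒ σ y             ≡⟨ cong (_⇒ σ y) (neg x) ⟩
      σ x ⁻ ⇒ σ y               ≡⟨ ⊕≡⁻⇒ (σ x) (σ y) ⟨
      σ x ⊕ σ y                 ∎

  σ𝟘≡𝟘⇔σ𝟙≡𝟙 : Preserves⁻ → (σ 𝟘 ≡ 𝟘) ⇔ (σ 𝟙 ≡ 𝟙)
  σ𝟘≡𝟘⇔σ𝟙≡𝟙 neg = mk⇔ to from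
    where
    to : σ 𝟘 ≡ 𝟘 → σ 𝟙 ≡ 𝟙
    to σ𝟘≡𝟘 = begin
      σ 𝟙        ≡⟨ cong σ 𝟘⁻≡𝟙 ⟨
      σ (𝟘 ⁻)    ≡⟨ neg 𝟘 ⟩
      σ 𝟘 ⁻      ≡⟨ cong _⁻ σ𝟘≡𝟘 ⟩
      𝟘 ⁻        ≡⟨ 𝟘⁻≡𝟙 ⟩
      𝟙          ∎

    from : σ 𝟙 ≡ 𝟙 → σ 𝟘 ≡ 𝟘
    from σ𝟙≡𝟙 = begin
      σ 𝟘        ≡⟨ cong σ 𝟙⁻≡𝟘 ⟨
      σ (𝟙 ⁻)    ≡⟨ neg 𝟙 ⟩
      σ 𝟙 ⁻      ≡⟨ cong _⁻ σ𝟙≡𝟙 ⟩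
      𝟙 ⁻        ≡⟨ 𝟙⁻≡𝟘 ⟩
      𝟘          ∎

  stateMV⇒state : IsStateMVOperator M σ → IsStateOperator M σ
  stateMV⇒state s = record
    { so-zero = Equivalence.from (σ𝟘≡𝟘⇔σ𝟙≡𝟙 mv-neg) mv-one
    ; so-⇒ = law
    ; so-⊙ = ⊙-law mv-neg law
    ; so-idem-⊙ = ⊙-idempotent mv-neg idem
    ; so-idem-⇒ = idem
    }
    where
    open IsStateMVOperator s
    law : ⇒-Law
    law = Equivalence.to (⊕-law⇔⇒-law mv-neg) mv-⊕
    idem : ⇒-Idempotent
    idem = Equivalence.to (⊕-idempotent⇔⇒-idempotent mv-neg) mv-idem

  state⇒stateMV : IsStateOperator M σ → IsStateMVOperator M σ
  state⇒stateMV s = record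
    { mv-one = Equivalence.to (σ𝟘≡𝟘⇔σ𝟙≡𝟙 neg) so-zero
    ; mv-neg = neg
    ; mv-⊕ = Equivalence.from (⊕-law⇔⇒-law neg) so-⇒
    ; mv-idem = Equivalence.from (⊕-idempotent⇔⇒-idempotent neg) so-idem-⇒
    }
    where
    open IsStateOperator s
    neg : Preserves⁻
    neg = ⁻-preserved so-zero so-⇒

  state⇒strongState : IsStateOperator M σ → IsStrongStateOperator M σ
  state⇒strongState s = record
    { sso-zero = so-zero
    ; sso-⇒ = so-⇒
    ; sso-⊙ = λ x y → trans (so-⊙ x y) (cong (λ w → σ x ⊙ σ w) (⇒-⊙-self x y))
    ; sso-idem-⊙ = so-idem-⊙
    ; sso-idem-⇒ = so-idem-⇒
    }
    where open IsStateOperator s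

proposition3p13 : (M : BLAlgebra) → IsMV M → (σ : BLAlgebra.Carrier M → BLAlgebra.Carrier M) →
    (IsStateMVOperator M σ ⇔ IsStateOperator M σ) × (IsStateOperator M σ → IsStrongStateOperator M σ)
proposition3p13 M involutive σ = mk⇔ stateMV⇒state state⇒stateMV , state⇒strongState
  where open StateOperators M involutive σ
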